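{- Let $R$ be a finite group, identified with its right regular permutation representation, and let $G\leq\mathrm{Sym}(R)$ be a transitive group properly containing $R$. Let $G_1$ be the stabilizer of $1$ in $G$, $K=\bigcap_{g\in G}R^g$, and let $H$ be the permutation group induced by $G_1$ on the set $R/K$ of cosets $Kx$. Let $\iota$ be the permutation of $R/K$ sending each element to its inverse, and let $\kappa$ be the number of $\langle H,\iota\rangle$-orbits on $R/K$. Let $\mathcal{L}$ be the set of inverse-closed subsets $S\subseteq R$ that intersect $\widetilde\Delta$ evenly for every $H$-orbit $\Delta$ on $R/K$, where $\widetilde\Delta$ is the union of the cosets in $\Delta$. Then $|\mathcal{L}|\leq 2^{\mathbf{c}(R)-\mathbf{c}(R/K)+\kappa}$.
   Context: $\mathcal{I}(X)$ is the set of elements of $X$ of order at most $2$ and $\mathbf{c}(X)=(|X|+|\mathcal{I}(X)|)/2$. A subset $S$ is inverse-closed if $S=S^{ -1}$. $S$ intersects $\widetilde\Delta=\Lambda_1\cup\dots\cup\Lambda_b$ (a union of $K$-cosets) evenly if $|S\cap\Lambda_1|=\dots=|S\cap\Lambda_b|$. -}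

module Defs where

open import Data.Nat using (ℕ; _+_; _*_; _^_; _/_; _≤_)
open import Data.Fin using (Fin)
open import Data.Fin.Properties using (any?; all?; _≟_)
open import Data.Fin.Subset using (Subset; _∈_)
open import Data.Fin.Subset.Properties using (_∈?_)
open import Data.List using (List; length; filter; allFin)
open import Data.List.Relation.Unary.All using (All)
open import Data.List.Relation.Unary.Any using (Any)
import Data.List.Relation.Unary.All as All
open import Data.Product using (Σ; ∃; _×_; _,_)
open import Data.Sum using (_⊎_)
open import Function using (_∘_)
open import Function.Definitions using (Injective)
open import Relation.Nullary using (¬_; Dec)
open import Relation.Nullary.Decidable using (_×-dec_)
open import Relation.Binary.PropositionalEquality using (_≡_)
open import Relation.Binary.Construct.Closure.Equivalence using (EqClosure)
open import Algebra.Structures using (IsGroup)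

-- A finite group of order n, realised on the carrier Fin n with
-- propositional equality (every finite group is isomorphic to one such).
record FinGroup (n : ℕ) : Set where
  field
    _∙_     : Fin n → Fin n → Fin n
    ε       : Fin n
    _⁻¹     : Fin n → Fin n
    isGroup : IsGroup _≡_ _∙_ ε _⁻¹

count : ∀ {n} {P : Fin n → Set} → (∀ x → Dec (P x)) → ℕ
count {n} P? = length (filter P? (allFin n))

-- "E has exactly k classes on the subset A": a family of k representatives
-- lying in A, pairwise non-related, such that each element of A is related
-- to one of them.
NumClassesOn : ∀ {n} → (Fin n → Set) → (Fin n → Fin n → Set) → ℕ → Set
NumClassesOn {n} A E k =
  Σ (Fin k → Fin n) λ rep →
    (∀ i → A (rep i)) ×
    (∀ i j → E (rep i) (rep j) → i ≡ j) ×
    (∀ x → A x → ∃ λ i → E x (rep i))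

-- The setting: R a finite group on Fin n, and G ≤ Sym(R) a finite set of
-- permutations of R, given as a list Gs of its elements (functions
-- Fin n → Fin n; duplicates allowed; membership is up to pointwise equality).
module Setting {n : ℕ} (𝑅 : FinGroup n) (Gs : List (Fin n → Fin n)) where
  open FinGroup 𝑅 public

  ρ : Fin n → Fin n → Fin n
  ρ r x = x ∙ r

  _∈G : (Fin n → Fin n) → Set
  f ∈G = Any (λ g → ∀ x → f x ≡ g x) Gs

  record IsPermGroup : Set where
    field
      perm  : All (λ g → Injective _≡_ _≡_ g) Gs
      id∈   : (λ x → x) ∈G
      comp∈ : All (λ f → All (λ g → (g ∘ f) ∈G) Gs) Gs
      inv∈  : All (λ f → ∃ λ g → g ∈G × (∀ x → g (f x) ≡ x)) Gs

  IsTransitive : Set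
  IsTransitive = ∀ x y → Any (λ g → g x ≡ y) Gs

  ContainsR : Set
  ContainsR = ∀ r → ρ r ∈G

  ProperOverR : Set
  ProperOverR = Any (λ g → ¬ (∃ λ r → ∀ x → g x ≡ ρ r x)) Gs

  -- K = ⋂_{g ∈ G} R^g : ρ k ∈ R^g  iff  g ∘ ρ k = ρ r' ∘ g for some r'
  InK : Fin n → Set
  InK k = All (λ g → ∃ λ r' → ∀ x → g (ρ k x) ≡ ρ r' (g x)) Gs

  InK? : ∀ k → Dec (InK k)
  InK? k = All.all? (λ g → any? (λ r' → all? (λ x → g (ρ k x) ≟ ρ r' (g x)))) Gs

  InCoset : Fin n → Fin n → Set
  InCoset y x = InK (y ∙ (x ⁻¹))

  SameCoset : Fin n → Fin n → Set
  SameCoset x y = InCoset y x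

  -- G₁ = stabiliser of the identity 1 of R; H = action of G₁ on R/K.
  -- Kx and Ky lie in the same H-orbit iff h(x) ∈ K y for some h ∈ G₁.
  HOrb : Fin n → Fin n → Set
  HOrb x y = Any (λ h → h ε ≡ ε × InCoset (h x) y) Gs

  -- generators of ⟨H, ι⟩ acting on R/K (lifted to representatives),
  -- together with moving inside a coset
  Step : Fin n → Fin n → Set
  Step x y = Any (λ h → h ε ≡ ε × h x ≡ y) Gs ⊎ (y ≡ x ⁻¹ ⊎ SameCoset x y)

  HιOrb : Fin n → Fin n → Set
  HιOrb = EqClosure Step

  numInvolR : ℕ
  numInvolR = count (λ x → (x ∙ x) ≟ ε)

  cR : ℕ
  cR = (n + numInvolR) / 2

  cosetMeet : Subset n → Fin n → ℕ
  cosetMeet S x = count (λ y → (y ∈? S) ×-dec InK? (y ∙ (x ⁻¹)))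

  InverseClosed : Subset n → Set
  InverseClosed S = (∀ y → y ∈ S → ∃ λ x → x ∈ S × y ≡ x ⁻¹)
                  × (∀ x → x ∈ S → (x ⁻¹) ∈ S)

  EvenOnHOrbits : Subset n → Set
  EvenOnHOrbits S = ∀ x y → HOrb x y → cosetMeet S x ≡ cosetMeet S y

  Inℒ : Subset n → Set
  Inℒ S = InverseClosed S × EvenOnHOrbits S

{-# OPTIONS --safe #-}
-- For S ∈ 𝓛 and a set B of ι-orbits on R/K, let S^B be S with the membership of r and r⁻¹ toggled,
-- where K r is a fixed coset in each orbit of B.  S^B is again inverse-closed, so it is determined by
-- its values on one element of each pair {x, x⁻¹}, i.e. by 𝐜(R) bits.  Add κ bits recording, for a
-- fixed coset K r′ of each ⟨H, ι⟩-orbit, whether the ι-orbit of K r′ lies in B.  These recover S on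
-- K r′, evenness and inverse-closure transport |S ∩ K r′| to every coset of that ⟨H, ι⟩-orbit, and
-- toggling changes |S ∩ K r| because S is constant on {r, r⁻¹}; so B, and then S, can be read off.
-- As R/K has 𝐜(R/K) ι-orbits, this injection gives |𝓛| · 2^𝐜(R/K) ≤ 2^(𝐜(R) + κ).
module Submission where

open import Defs
open import Data.Nat using (ℕ; _+_; _*_; _^_; _/_; _≤_)
open import Data.Fin using (Fin)
open import Data.Fin.Subset using (Subset)
open import Data.List using (List; length)
open import Data.List.Relation.Unary.All using (All)
open import Data.List.Relation.Unary.Unique.Propositional using (Unique)
open import Data.Unit using (⊤)

open import Algebra.Bundles using (Group)
open import Algebra.Structures using (IsGroup)
import Algebra.Properties.Group as GroupProperties
open import Data.Bool using (Bool; true; false; not; if_then_else_; _∧_; _∨_; _xor_; T)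
open import Data.Bool.Properties using (∨-comm; xor-identityʳ; xor-assoc; xor-same)
import Data.Fin as Fin
open import Data.Fin using (zero; suc; inject≤; _↑ˡ_; _↑ʳ_; remQuot; combine; funToFin; finToFun)
open import Data.Fin.Properties as Finₚ using (_≟_; _≤?_; any?; inject≤-injective)
import Data.Fin.Permutation as Permutation
open import Data.Fin.Subset using (_∈_; _∉_)
open import Data.Fin.Subset.Properties using (_∈?_)
import Data.List as List
open import Data.List using (filter; allFin)
import Data.List.Relation.Unary.All as All
open import Data.List.Relation.Unary.All.Properties using (all-filter)
open import Data.List.Relation.Unary.Any as Any using (Any; index)
open import Data.List.Relation.Unary.Any.Properties using (lookup-index)
open import Data.List.Relation.Unary.AllPairs using (_∷_)
open import Data.List.Relation.Unary.Unique.Propositional.Properties using (filter⁺; allFin⁺)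
open import Data.List.Membership.Propositional.Properties using (∈-lookup; ∈-filter⁺; ∈-allFin)
open import Data.Nat as ℕ using (_<_; s≤s; z≤n)
open import Data.Nat.Properties hiding (_≟_; _≤?_)
open import Data.Nat.DivMod using (m*n/n≡m; /-monoˡ-≤)
open import Data.Product using (∃; _×_; _,_; proj₁; proj₂; uncurry)
open import Data.Sum using (inj₁; inj₂; [_,_]′)
open import Data.Empty using (⊥; ⊥-elim)
open import Data.Unit using (tt)
open import Data.Vec using (lookup; tabulate)
open import Data.Vec.Properties using ([]=⇒lookup; lookup⇒[]=; tabulate∘lookup; tabulate-cong)
open import Data.Vec.Functional using (_++_)
open import Data.Vec.Functional.Properties using (lookup-++ˡ; lookup-++ʳ)
open import Function using (_∘_; id; Inverse; mk⇔)
open import Function.Definitions using (Injective)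
open import Relation.Binary.Definitions using (tri<; tri≈; tri>)
open import Relation.Binary.PropositionalEquality
open import Relation.Binary.Construct.Closure.ReflexiveTransitive using (_◅_) renaming (ε to [])
open import Relation.Binary.Construct.Closure.Symmetric using (fwd; bwd)
open import Relation.Nullary using (Dec; yes; no; does; ¬_)
open import Relation.Nullary.Decidable using (_×-dec_; T?; dec-true; dec-false; does-⇔)
open import Relation.Nullary.Negation using (contradiction)
open import Level using (0ℓ)
open import Relation.Unary using (Pred; Decidable)
open import Algebra.Properties.CommutativeMonoid.Sum +-0-commutativeMonoid
  using (sum; sum-cong-≗; sum-permute; ∑-distrib-+)

private
  variable
    a m : ℕ
    P Q : Set

indicator : Dec P → ℕ
indicator P? = if does P? then 1 else 0

indicator-yes : (P? : Dec P) → P → indicator P? ≡ 1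
indicator-yes (yes _) _ = refl
indicator-yes (no ¬p) p = contradiction p ¬p

indicator-no : (P? : Dec P) → ¬ P → indicator P? ≡ 0
indicator-no (yes p) ¬p = contradiction p ¬p
indicator-no (no _)  _  = refl

indicator-mono : (P? : Dec P) (Q? : Dec Q) → (P → Q) → indicator P? ≤ indicator Q?
indicator-mono (yes p) Q? f = ≤-reflexive (sym (indicator-yes Q? (f p)))
indicator-mono (no _)  Q? f = z≤n

indicator-cong : (P? : Dec P) (Q? : Dec Q) → (P → Q) → (Q → P) → indicator P? ≡ indicator Q?
indicator-cong P? Q? f g = ≤-antisym (indicator-mono P? Q? f) (indicator-mono Q? P? g)

count-tabulate : ∀ {A : Set} {P : Pred A 0ℓ} (P? : Decidable P) (f : Fin m → A) →
  length (filter P? (List.tabulate f)) ≡ sum (λ x → indicator (P? (f x)))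
count-tabulate {ℕ.zero}  P? f = refl
count-tabulate {ℕ.suc m} P? f with does (P? (f zero))
... | true  = cong ℕ.suc (count-tabulate P? (f ∘ suc))
... | false = count-tabulate P? (f ∘ suc)

count≡sum : ∀ {P : Pred (Fin m) 0ℓ} (P? : Decidable P) → count P? ≡ sum (λ x → indicator (P? x))
count≡sum P? = count-tabulate P? id

sum-mono-≤ : ∀ {f g : Fin m → ℕ} → (∀ x → f x ≤ g x) → sum f ≤ sum g
sum-mono-≤ {ℕ.zero}  f≤g = z≤n
sum-mono-≤ {ℕ.suc m} f≤g = +-mono-≤ (f≤g zero) (sum-mono-≤ (f≤g ∘ suc))

sum-mono-< : ∀ {f g : Fin m → ℕ} → (∀ x → f x ≤ g x) → ∀ x → f x < g x → sum f < sum g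
sum-mono-< f≤g zero    fx<gx = +-mono-<-≤ fx<gx (sum-mono-≤ (f≤g ∘ suc))
sum-mono-< f≤g (suc x) fx<gx = +-mono-≤-< (f≤g zero) (sum-mono-< (f≤g ∘ suc) x fx<gx)

count-mono : ∀ {P Q : Pred (Fin m) 0ℓ} (P? : Decidable P) (Q? : Decidable Q) →
  (∀ x → P x → Q x) → count P? ≤ count Q?
count-mono P? Q? P⇒Q = begin
  count P?                        ≡⟨ count≡sum P? ⟩
  sum (λ x → indicator (P? x))    ≤⟨ sum-mono-≤ (λ x → indicator-mono (P? x) (Q? x) (P⇒Q x)) ⟩
  sum (λ x → indicator (Q? x))    ≡⟨ count≡sum Q? ⟨
  count Q?                        ∎
  where open ≤-Reasoning

Unique⇒lookup-injective : ∀ {A : Set} {xs : List A} → Unique xs → Injective _≡_ _≡_ (List.lookup xs)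
Unique⇒lookup-injective (_ ∷ _)    {zero}  {zero}  _ = refl
Unique⇒lookup-injective (x∉ ∷ _)   {zero}  {suc j} e = contradiction e (All.lookup x∉ (∈-lookup j))
Unique⇒lookup-injective (x∉ ∷ _)   {suc i} {zero}  e = contradiction (sym e) (All.lookup x∉ (∈-lookup i))
Unique⇒lookup-injective (_ ∷ uniq) {suc i} {suc j} e = cong suc (Unique⇒lookup-injective uniq e)

module _ {P : Pred (Fin m) 0ℓ} (P? : Decidable P) where

  enumerate : Fin (count P?) → Fin m
  enumerate = List.lookup (filter P? (allFin m))

  enumerate-sound : ∀ k → P (enumerate k)
  enumerate-sound k = All.lookup (all-filter P? (allFin m)) (∈-lookup k)

  enumerate-surjective : ∀ {x} → P x → ∃ λ k → enumerate k ≡ x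
  enumerate-surjective {x} px = index x∈ , sym (lookup-index x∈)
    where x∈ = ∈-filter⁺ P? (∈-allFin x) px

  enumerate-injective : Injective _≡_ _≡_ enumerate
  enumerate-injective = Unique⇒lookup-injective (filter⁺ P? (allFin⁺ m))

  injection⇒≤count : (f : Fin a → Fin m) → Injective _≡_ _≡_ f → (∀ y → P (f y)) → a ≤ count P?
  injection⇒≤count f f-injective Pf = Finₚ.injective⇒≤ position-injective
    where
    position : _ → Fin (count P?)
    position y = proj₁ (enumerate-surjective (Pf y))
    position-injective : Injective _≡_ _≡_ position
    position-injective {y} {y′} e = f-injective (begin
      f y                    ≡⟨ proj₂ (enumerate-surjective (Pf y)) ⟨
      enumerate (position y)  ≡⟨ cong enumerate e ⟩
      enumerate (position y′) ≡⟨ proj₂ (enumerate-surjective (Pf y′)) ⟩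
      f y′                   ∎)
      where open ≡-Reasoning

sum-involution : (σ : Fin m → Fin m) → (∀ j → σ (σ j) ≡ j) → (f : Fin m → ℕ) → sum f ≡ sum (f ∘ σ)
sum-involution σ σ-involutive f = sum-permute f (Permutation.permutation σ σ σ-involutive σ-involutive)

indicator-≤-total : (i j : Fin m) → indicator (i ≤? j) + indicator (j ≤? i) ≡ 1 + indicator (j ≟ i)
indicator-≤-total i j with Finₚ.<-cmp i j
... | tri< i<j _ _
  rewrite indicator-yes (i ≤? j) (<⇒≤ i<j) | indicator-no (j ≤? i) (<⇒≱ i<j)
        | indicator-no (j ≟ i) (Finₚ.<⇒≢ i<j ∘ sym) = refl
... | tri≈ _ refl _
  rewrite indicator-yes (i ≤? i) (Finₚ.≤-refl {x = i}) | indicator-yes (i ≟ i) refl = refl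
... | tri> _ _ j<i
  rewrite indicator-no (i ≤? j) (<⇒≱ j<i) | indicator-yes (j ≤? i) (<⇒≤ j<i)
        | indicator-no (j ≟ i) (Finₚ.<⇒≢ j<i) = refl

module _ (σ : Fin m → Fin m) (σ-involutive : ∀ j → σ (σ j) ≡ j) where

  count-≤σ-twice : count (λ j → j ≤? σ j) + count (λ j → j ≤? σ j) ≡ m + count (λ j → σ j ≟ j)
  count-≤σ-twice = begin
    count (λ j → j ≤? σ j) + count (λ j → j ≤? σ j)  ≡⟨ cong₂ _+_ (count≡sum λ j → j ≤? σ j) (count≡sum λ j → j ≤? σ j) ⟩
    sum below + sum below                           ≡⟨ cong (sum below +_) (sum-involution σ σ-involutive below) ⟩
    sum below + sum (below ∘ σ)                     ≡⟨ ∑-distrib-+ below (below ∘ σ) ⟨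
    sum (λ j → below j + below (σ j))               ≡⟨ sum-cong-≗ pointwise ⟩
    sum (λ j → 1 + fixed j)                         ≡⟨ ∑-distrib-+ (λ _ → 1) fixed ⟩
    sum {m} (λ _ → 1) + sum fixed                   ≡⟨ cong₂ _+_ (sum-ones m) (sym (count≡sum λ j → σ j ≟ j)) ⟩
    m + count (λ j → σ j ≟ j)                       ∎
    where
    open ≡-Reasoning
    below fixed : Fin m → ℕ
    below j = indicator (j ≤? σ j)
    fixed j = indicator (σ j ≟ j)
    pointwise : ∀ j → below j + below (σ j) ≡ 1 + fixed j
    pointwise j rewrite σ-involutive j = indicator-≤-total j (σ j)
    sum-ones : ∀ k → sum {k} (λ _ → 1) ≡ k
    sum-ones ℕ.zero    = refl
    sum-ones (ℕ.suc k) = cong ℕ.suc (sum-ones k)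

  count-≤σ≡half : count (λ j → j ≤? σ j) ≡ (m + count (λ j → σ j ≟ j)) / 2
  count-≤σ≡half = begin
    #≤                               ≡⟨ m*n/n≡m #≤ 2 ⟨
    (#≤ * 2) / 2                     ≡⟨ cong (_/ 2) (trans (*-comm #≤ 2) (cong (#≤ +_) (+-identityʳ #≤))) ⟩
    (#≤ + #≤) / 2                    ≡⟨ cong (_/ 2) count-≤σ-twice ⟩
    (m + count (λ j → σ j ≟ j)) / 2  ∎
    where
    open ≡-Reasoning
    #≤ = count (λ j → j ≤? σ j)

funToFin-cong : ∀ {k} {f g : Fin m → Fin k} → f ≗ g → funToFin f ≡ funToFin g
funToFin-cong {ℕ.zero}  f≗g = refl
funToFin-cong {ℕ.suc m} f≗g = cong₂ combine (f≗g zero) (funToFin-cong (f≗g ∘ suc))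

injective-encoding⇒≤ : ∀ {c} (encode : Fin a → (Fin c → Bool) → Fin m → Bool) →
  (∀ {l l′ u u′} → encode l u ≗ encode l′ u′ → l ≡ l′ × u ≗ u′) → a * 2 ^ c ≤ 2 ^ m
injective-encoding⇒≤ {a} {m} {c} encode encode-injective = Finₚ.injective⇒≤ code-injective
  where
  open Inverse Finₚ.2↔Bool using (to; from; strictlyInverseˡ; strictlyInverseʳ)

  toWord : ∀ {k} → (Fin k → Bool) → Fin (2 ^ k)
  toWord {k} u = funToFin {k} {2} (from ∘ u)

  fromWord : ∀ {k} → Fin (2 ^ k) → Fin k → Bool
  fromWord {k} w = to ∘ finToFun {2} {k} w

  fromWord-toWord : ∀ {k} (u : Fin k → Bool) → fromWord (toWord u) ≗ u
  fromWord-toWord {k} u j = trans (cong to (Finₚ.finToFun-funToFin {k} {2} (from ∘ u) j)) (strictlyInverseˡ (u j))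

  fromWord-injective : ∀ {k} {w w′ : Fin (2 ^ k)} → fromWord {k} w ≗ fromWord w′ → w ≡ w′
  fromWord-injective {k} {w} {w′} eq = begin
    w                          ≡⟨ Finₚ.funToFin-finToFin {k} {2} w ⟨
    funToFin (finToFun {2} {k} w)  ≡⟨ funToFin-cong {k} (λ j → trans (sym (strictlyInverseʳ _)) (trans (cong from (eq j)) (strictlyInverseʳ _))) ⟩
    funToFin (finToFun {2} {k} w′) ≡⟨ Finₚ.funToFin-finToFin {k} {2} w′ ⟩
    w′                         ∎
    where open ≡-Reasoning

  code : Fin (a * 2 ^ c) → Fin (2 ^ m)
  code w = toWord (encode (proj₁ (remQuot {a} (2 ^ c) w)) (fromWord (proj₂ (remQuot {a} (2 ^ c) w))))

  code-injective : Injective _≡_ _≡_ code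
  code-injective {w} {w′} eq = begin
    w                                  ≡⟨ Finₚ.combine-remQuot {a} (2 ^ c) w ⟨
    uncurry combine (remQuot {a} (2 ^ c) w)  ≡⟨ cong₂ combine l≡l′ (fromWord-injective {c} u≗u′) ⟩
    uncurry combine (remQuot {a} (2 ^ c) w′) ≡⟨ Finₚ.combine-remQuot {a} (2 ^ c) w′ ⟩
    w′                                 ∎
    where
    open ≡-Reasoning
    decoded = encode-injective (λ j → begin
      _ ≡⟨ fromWord-toWord _ j ⟨
      fromWord (code w) j ≡⟨ cong (λ t → fromWord t j) eq ⟩
      fromWord (code w′) j ≡⟨ fromWord-toWord _ j ⟩
      _ ∎)
    l≡l′ = proj₁ decoded
    u≗u′ = proj₂ decoded

≡-from-T : ∀ {m} b → (T b → m ≡ true) → (¬ T b → m ≡ false) → m ≡ b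
≡-from-T true  T⇒m _  = T⇒m _
≡-from-T false _  ¬T⇒m = ¬T⇒m λ ()

≡-unless-opposite : ∀ {u v} → (u ≡ true → v ≡ false → ⊥) → (u ≡ false → v ≡ true → ⊥) → u ≡ v
≡-unless-opposite {false} {false} _ _ = refl
≡-unless-opposite {true}  {true}  _ _ = refl
≡-unless-opposite {true}  {false} tf _ = ⊥-elim (tf refl refl)
≡-unless-opposite {false} {true}  _ ft = ⊥-elim (ft refl refl)

xor-≡true-from-left : ∀ {s p} → (p ≡ true → s ≡ false) → s ≡ true → s xor p ≡ true
xor-≡true-from-left {p = false} _     refl = refl
xor-≡true-from-left {p = true}  p⇒¬s refl = contradiction (p⇒¬s refl) λ ()

xor-≡true-to-left : ∀ {s p} → (p ≡ true → s ≡ true) → s xor p ≡ true → s ≡ true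
xor-≡true-to-left {s} {false} _   s⊕p = trans (sym (xor-identityʳ s)) s⊕p
xor-≡true-to-left {s} {true}  p⇒s _   = p⇒s refl

module Cosets {n} (𝑅 : FinGroup n) (Gs : List (Fin n → Fin n)) where
  open Setting 𝑅 Gs
  open IsGroup isGroup using (assoc; identityˡ; identityʳ; inverseˡ; inverseʳ)

  group : Group _ _
  group = record { isGroup = isGroup }

  open GroupProperties group public
    using (⁻¹-involutive; ⁻¹-injective; ⁻¹-anti-homo-∙; //-rightDividesˡ; //-rightDividesʳ; \\-leftDividesʳ)

  K-ε : InK ε
  K-ε = All.tabulate λ {g} _ → ε , λ x → trans (cong g (identityʳ x)) (sym (identityʳ (g x)))

  K-∙ : ∀ {a b} → InK a → InK b → InK (a ∙ b)
  K-∙ {a} {b} Ka Kb = All.zipWith (λ { {g} ((r , g-a) , (r′ , g-b)) → r ∙ r′ , λ x → begin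
    g (x ∙ (a ∙ b))    ≡⟨ cong g (assoc x a b) ⟨
    g ((x ∙ a) ∙ b)    ≡⟨ g-b (x ∙ a) ⟩
    g (x ∙ a) ∙ r′     ≡⟨ cong (_∙ r′) (g-a x) ⟩
    (g x ∙ r) ∙ r′     ≡⟨ assoc (g x) r r′ ⟩
    g x ∙ (r ∙ r′)     ∎ }) (Ka , Kb)
    where open ≡-Reasoning

  K-⁻¹ : ∀ {a} → InK a → InK (a ⁻¹)
  K-⁻¹ {a} = All.map λ { {g} (r , g-a) → r ⁻¹ , λ x → begin
    g (x ∙ (a ⁻¹))                   ≡⟨ //-rightDividesʳ r _ ⟨
    (g (x ∙ (a ⁻¹)) ∙ r) ∙ (r ⁻¹)     ≡⟨ cong (_∙ (r ⁻¹)) (g-a (x ∙ (a ⁻¹))) ⟨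
    g ((x ∙ (a ⁻¹)) ∙ a) ∙ (r ⁻¹)     ≡⟨ cong (λ t → g t ∙ (r ⁻¹)) (//-rightDividesˡ a x) ⟩
    g x ∙ (r ⁻¹)                     ∎ }
    where open ≡-Reasoning

  infix 4 _~_
  _~_ : Fin n → Fin n → Set
  _~_ = SameCoset

  ~-refl : ∀ x → x ~ x
  ~-refl x = subst InK (sym (inverseʳ x)) K-ε

  ~-sym : ∀ {x y} → x ~ y → y ~ x
  ~-sym {x} {y} x~y = subst InK (trans (⁻¹-anti-homo-∙ y (x ⁻¹)) (cong (_∙ (y ⁻¹)) (⁻¹-involutive x))) (K-⁻¹ x~y)

  ~-trans : ∀ {x y z} → x ~ y → y ~ z → x ~ z
  ~-trans {x} {y} {z} x~y y~z = subst InK zy⁻¹yx⁻¹≡zx⁻¹ (K-∙ y~z x~y)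
    where
    zy⁻¹yx⁻¹≡zx⁻¹ : (z ∙ (y ⁻¹)) ∙ (y ∙ (x ⁻¹)) ≡ z ∙ (x ⁻¹)
    zy⁻¹yx⁻¹≡zx⁻¹ = trans (assoc z (y ⁻¹) _) (cong (z ∙_) (\\-leftDividesʳ y (x ⁻¹)))

  member-⁻¹ : ∀ {S} → InverseClosed S → ∀ x → lookup S (x ⁻¹) ≡ lookup S x
  member-⁻¹ {S} (_ , closed) x with lookup S x in e | lookup S (x ⁻¹) in e′
  ... | true  | true  = refl
  ... | false | false = refl
  ... | true  | false = contradiction (trans (sym ([]=⇒lookup (closed x (lookup⇒[]= x S e)))) e′) λ ()
  ... | false | true  = contradiction (trans (sym ([]=⇒lookup (subst (_∈ S) (⁻¹-involutive x) (closed _ (lookup⇒[]= _ S e′))))) e) λ ()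

  meets? : ∀ S x y → Dec (y ∈ S × x ~ y)
  meets? S x y = (y ∈? S) ×-dec InK? (y ∙ (x ⁻¹))

  meets : Subset n → Fin n → Fin n → ℕ
  meets S x y = indicator (meets? S x y)

  cosetMeet≡sum : ∀ S x → cosetMeet S x ≡ sum (meets S x)
  cosetMeet≡sum S x = count≡sum (meets? S x)

  module _ {S S′ : Subset n} {x : Fin n} (S⊆S′ : ∀ y → x ~ y → y ∈ S → y ∈ S′) where

    meets-mono : ∀ y → meets S x y ≤ meets S′ x y
    meets-mono y = indicator-mono (meets? S x y) (meets? S′ x y) λ (y∈S , x~y) → S⊆S′ y x~y y∈S , x~y

    cosetMeet-mono : cosetMeet S x ≤ cosetMeet S′ x
    cosetMeet-mono = begin
      cosetMeet S x     ≡⟨ cosetMeet≡sum S x ⟩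
      sum (meets S x)   ≤⟨ sum-mono-≤ meets-mono ⟩
      sum (meets S′ x)  ≡⟨ cosetMeet≡sum S′ x ⟨
      cosetMeet S′ x    ∎
      where open ≤-Reasoning

    cosetMeet-mono-< : x ∉ S → x ∈ S′ → cosetMeet S x < cosetMeet S′ x
    cosetMeet-mono-< x∉S x∈S′ = begin-strict
      cosetMeet S x     ≡⟨ cosetMeet≡sum S x ⟩
      sum (meets S x)   <⟨ sum-mono-< meets-mono x meets-at-x ⟩
      sum (meets S′ x)  ≡⟨ cosetMeet≡sum S′ x ⟨
      cosetMeet S′ x    ∎
      where
      open ≤-Reasoning
      meets-at-x : meets S x x < meets S′ x x
      meets-at-x rewrite indicator-no (meets? S x x) (x∉S ∘ proj₁)
                       | indicator-yes (meets? S′ x x) (x∈S′ , ~-refl x) = s≤s z≤n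

  cosetMeet-agree : ∀ {S S′ x} → (∀ y → x ~ y → lookup S y ≡ lookup S′ y) → cosetMeet S x ≡ cosetMeet S′ x
  cosetMeet-agree {S} {S′} eq = ≤-antisym
    (cosetMeet-mono λ y x~y y∈S → lookup⇒[]= y S′ (trans (sym (eq y x~y)) ([]=⇒lookup y∈S)))
    (cosetMeet-mono λ y x~y y∈S′ → lookup⇒[]= y S (trans (eq y x~y) ([]=⇒lookup y∈S′)))

  inPair : Fin n → Fin n → Bool
  inPair y x = does (y ≟ x) ∨ does (y ≟ x ⁻¹)

  inPair-self : ∀ x → inPair x x ≡ true
  inPair-self x rewrite dec-true (x ≟ x) refl = refl

  inPair-⁻¹ : ∀ y x → inPair (y ⁻¹) x ≡ inPair y x
  inPair-⁻¹ y x = trans (cong₂ _∨_ (does-⇔ y⁻¹≡x⇔y≡x⁻¹ ((y ⁻¹) ≟ x) (y ≟ x ⁻¹)) (does-⇔ y⁻¹≡x⁻¹⇔y≡x ((y ⁻¹) ≟ x ⁻¹) (y ≟ x)))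
    (∨-comm (does (y ≟ x ⁻¹)) (does (y ≟ x)))
    where
    y⁻¹≡x⇔y≡x⁻¹ = mk⇔ (λ e → trans (sym (⁻¹-involutive y)) (cong _⁻¹ e)) (λ e → trans (cong _⁻¹ e) (⁻¹-involutive x))
    y⁻¹≡x⁻¹⇔y≡x = mk⇔ ⁻¹-injective (cong _⁻¹)

  inPair-member : ∀ {S} → InverseClosed S → ∀ {y x} → inPair y x ≡ true → lookup S y ≡ lookup S x
  inPair-member closed {y} {x} _ with y ≟ x | y ≟ x ⁻¹
  inPair-member closed {x = x} _ | yes refl | _        = refl
  inPair-member closed {x = x} _ | no _     | yes refl = member-⁻¹ closed x
  inPair-member closed         () | no _     | no _

  -- S′ is constant on {x, x⁻¹}, so S ∩ K x is a proper superset or a proper subset of S′ ∩ K x.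
  cosetMeet-toggle : ∀ {S S′ x} → InverseClosed S′ →
    (∀ y → x ~ y → lookup S y ≡ lookup S′ y xor inPair y x) → cosetMeet S x ≢ cosetMeet S′ x
  cosetMeet-toggle {S} {S′} {x} closed′ toggled with lookup S′ x in e
  ... | false = (<⇒≢ (cosetMeet-mono-< S′⊆S x∉S′ x∈S)) ∘ sym
    where
    S′⊆S : ∀ y → x ~ y → y ∈ S′ → y ∈ S
    S′⊆S y x~y y∈S′ = lookup⇒[]= y S (trans (toggled y x~y)
      (xor-≡true-from-left (λ p → trans (inPair-member closed′ p) e) ([]=⇒lookup y∈S′)))
    x∉S′ : x ∉ S′
    x∉S′ x∈S′ = contradiction (trans (sym ([]=⇒lookup x∈S′)) e) λ ()
    x∈S : x ∈ S
    x∈S = lookup⇒[]= x S (trans (toggled x (~-refl x)) (trans (cong (_xor inPair x x) e) (inPair-self x)))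
  ... | true = <⇒≢ (cosetMeet-mono-< S⊆S′ x∉S x∈S′)
    where
    S⊆S′ : ∀ y → x ~ y → y ∈ S → y ∈ S′
    S⊆S′ y x~y y∈S = lookup⇒[]= y S′
      (xor-≡true-to-left (λ p → trans (inPair-member closed′ p) e) (trans (sym (toggled y x~y)) ([]=⇒lookup y∈S)))
    x∉S : x ∉ S
    x∉S x∈S = contradiction
      (trans (sym ([]=⇒lookup x∈S)) (trans (toggled x (~-refl x)) (trans (cong (_xor inPair x x) e) (cong not (inPair-self x)))))
      λ ()
    x∈S′ : x ∈ S′
    x∈S′ = lookup⇒[]= x S′ e

  count-≤⁻¹≤cR : count (λ x → x ≤? x ⁻¹) ≤ cR
  count-≤⁻¹≤cR = begin
    count (λ x → x ≤? x ⁻¹)                  ≡⟨ count-≤σ≡half _⁻¹ ⁻¹-involutive ⟩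
    (n + count (λ x → (x ⁻¹) ≟ x)) / 2       ≤⟨ /-monoˡ-≤ 2 (+-monoʳ-≤ n (count-mono _ _ self-inverse⇒involution)) ⟩
    (n + numInvolR) / 2                     ∎
    where
    open ≤-Reasoning
    self-inverse⇒involution : ∀ x → x ⁻¹ ≡ x → x ∙ x ≡ ε
    self-inverse⇒involution x x⁻¹≡x = trans (cong (x ∙_) (sym x⁻¹≡x)) (inverseʳ x)

  module Normal (G : IsPermGroup) (R≤G : ContainsR) where
    open IsPermGroup G using (comp∈)

    -- Conjugation by ρ r permutes the groups R^g, as g ∘ ρ r ∈ G.
    K-normal : ∀ {k} → InK k → ∀ r → InK (((r ⁻¹) ∙ k) ∙ r)
    K-normal {k} Kk r with All.lookupAny comp∈ (R≤G r)
    ... | ∘f∈G , ρr≗f = All.map (λ {g} → conjugated g) ∘f∈G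
      where
      f = Any.lookup (R≤G r)
      conjugated : ∀ g → (g ∘ f) ∈G → ∃ λ r′ → ∀ x → g (x ∙ (((r ⁻¹) ∙ k) ∙ r)) ≡ g x ∙ r′
      conjugated g g∘f∈G with All.lookupAny Kk g∘f∈G
      ... | (r′ , h-k) , g∘f≗h = r′ , λ x → begin
        g (x ∙ (((r ⁻¹) ∙ k) ∙ r))    ≡⟨ cong g (trans (sym (assoc x _ r)) (cong (_∙ r) (sym (assoc x (r ⁻¹) k)))) ⟩
        g (((x ∙ (r ⁻¹)) ∙ k) ∙ r)    ≡⟨ cong g (ρr≗f _) ⟩
        g (f ((x ∙ (r ⁻¹)) ∙ k))      ≡⟨ g∘f≗h _ ⟩
        h ((x ∙ (r ⁻¹)) ∙ k)          ≡⟨ h-k _ ⟩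
        h (x ∙ (r ⁻¹)) ∙ r′           ≡⟨ cong (_∙ r′) (g∘f≗h _) ⟨
        g (f (x ∙ (r ⁻¹))) ∙ r′       ≡⟨ cong (λ t → g t ∙ r′) (ρr≗f _) ⟨
        g ((x ∙ (r ⁻¹)) ∙ r) ∙ r′     ≡⟨ cong (λ t → g t ∙ r′) (//-rightDividesˡ r x) ⟩
        g x ∙ r′                      ∎
        where
        open ≡-Reasoning
        h = Any.lookup g∘f∈G

    K-swap : ∀ {a b} → InK (a ∙ b) → InK (b ∙ a)
    K-swap {a} {b} Kab = subst InK a⁻¹[ab]a≡ba (K-normal Kab a)
      where
      a⁻¹[ab]a≡ba : ((a ⁻¹) ∙ (a ∙ b)) ∙ a ≡ b ∙ a
      a⁻¹[ab]a≡ba = cong (_∙ a) (\\-leftDividesʳ a b)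

    ~-⁻¹ : ∀ {x y} → x ~ y → (x ⁻¹) ~ (y ⁻¹)
    ~-⁻¹ {x} {y} x~y = subst InK (cong ((y ⁻¹) ∙_) (sym (⁻¹-involutive x))) (K-swap (~-sym x~y))

    ~-selfInverse : ∀ {x} → InK (x ∙ x) → (x ⁻¹) ~ x
    ~-selfInverse {x} = subst InK (cong (x ∙_) (sym (⁻¹-involutive x)))

    cosetMeet-cong : ∀ S {x y} → x ~ y → cosetMeet S x ≡ cosetMeet S y
    cosetMeet-cong S {x} {y} x~y = begin
      cosetMeet S x    ≡⟨ cosetMeet≡sum S x ⟩
      sum (meets S x)  ≡⟨ sum-cong-≗ (λ z → indicator-cong (meets? S x z) (meets? S y z) (λ (z∈S , x~z) → z∈S , ~-trans (~-sym x~y) x~z)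
                                                            (λ (z∈S , y~z) → z∈S , ~-trans x~y y~z)) ⟩
      sum (meets S y)  ≡⟨ cosetMeet≡sum S y ⟨
      cosetMeet S y    ∎
      where open ≡-Reasoning

    cosetMeet-⁻¹ : ∀ {S} → InverseClosed S → ∀ x → cosetMeet S x ≡ cosetMeet S (x ⁻¹)
    cosetMeet-⁻¹ {S} (_ , closed) x = begin
      cosetMeet S x                       ≡⟨ cosetMeet≡sum S x ⟩
      sum (meets S x)                     ≡⟨ sum-cong-≗ meets-⁻¹ ⟩
      sum (meets S (x ⁻¹) ∘ _⁻¹)           ≡⟨ sum-involution _⁻¹ ⁻¹-involutive (meets S (x ⁻¹)) ⟨
      sum (meets S (x ⁻¹))                 ≡⟨ cosetMeet≡sum S (x ⁻¹) ⟨
      cosetMeet S (x ⁻¹)                   ∎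
      where
      open ≡-Reasoning
      meets-⁻¹ : ∀ y → meets S x y ≡ meets S (x ⁻¹) (y ⁻¹)
      meets-⁻¹ y = indicator-cong (meets? S x y) (meets? S (x ⁻¹) (y ⁻¹)) (λ (y∈S , x~y) → closed y y∈S , ~-⁻¹ x~y)
        (λ (y⁻¹∈S , x⁻¹~y⁻¹) → subst (_∈ S) (⁻¹-involutive y) (closed _ y⁻¹∈S) ,
                              subst₂ _~_ (⁻¹-involutive x) (⁻¹-involutive y) (~-⁻¹ x⁻¹~y⁻¹))

    cosetMeet-step : ∀ {S} → Inℒ S → ∀ {x y} → Step x y → cosetMeet S x ≡ cosetMeet S y
    cosetMeet-step (_ , even) {x} {y} (inj₁ h∈G₁) = even x y (Any.map (λ (hε≡ε , hx≡y) → hε≡ε , subst (y ~_) (sym hx≡y) (~-refl y)) h∈G₁)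
    cosetMeet-step (closed , _) {x} (inj₂ (inj₁ refl)) = cosetMeet-⁻¹ closed x
    cosetMeet-step {S} _ (inj₂ (inj₂ x~y)) = cosetMeet-cong S x~y

    cosetMeet-orbit : ∀ {S} → Inℒ S → ∀ {x y} → HιOrb x y → cosetMeet S x ≡ cosetMeet S y
    cosetMeet-orbit S∈ℒ []           = refl
    cosetMeet-orbit S∈ℒ (fwd s ◅ ss) = trans (cosetMeet-step S∈ℒ s) (cosetMeet-orbit S∈ℒ ss)
    cosetMeet-orbit S∈ℒ (bwd s ◅ ss) = trans (sym (cosetMeet-step S∈ℒ s)) (cosetMeet-orbit S∈ℒ ss)

module Encoding {n} (𝑅 : FinGroup n) (Gs : List (Fin n → Fin n))
  (G : Setting.IsPermGroup 𝑅 Gs) (R≤G : Setting.ContainsR 𝑅 Gs) (q i κ : ℕ)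
  (R/K : NumClassesOn (λ _ → ⊤) (Setting.SameCoset 𝑅 Gs) q)
  (I[R/K] : NumClassesOn (λ x → Setting.InK 𝑅 Gs (Setting._∙_ 𝑅 Gs x x)) (Setting.SameCoset 𝑅 Gs) i)
  (orbits : NumClassesOn (λ _ → ⊤) (Setting.HιOrb 𝑅 Gs) κ) where

  open Setting 𝑅 Gs
  open Cosets 𝑅 Gs
  open Normal G R≤G

  repQ : Fin q → Fin n
  repQ = proj₁ R/K

  coset : Fin n → Fin q
  coset x = proj₁ (proj₂ (proj₂ (proj₂ R/K)) x tt)

  ~-repQ-coset : ∀ x → x ~ repQ (coset x)
  ~-repQ-coset x = proj₂ (proj₂ (proj₂ (proj₂ R/K)) x tt)

  coset-cong : ∀ {x y} → x ~ y → coset x ≡ coset y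
  coset-cong {x} {y} x~y = proj₁ (proj₂ (proj₂ R/K)) _ _
    (~-trans (~-sym (~-repQ-coset x)) (~-trans x~y (~-repQ-coset y)))

  coset-repQ : ∀ j → coset (repQ j) ≡ j
  coset-repQ j = proj₁ (proj₂ (proj₂ R/K)) _ _ (~-sym (~-repQ-coset (repQ j)))

  ι : Fin q → Fin q
  ι j = coset (repQ j ⁻¹)

  coset-⁻¹ : ∀ x → coset (x ⁻¹) ≡ ι (coset x)
  coset-⁻¹ x = coset-cong (~-⁻¹ (~-repQ-coset x))

  ι-involutive : ∀ j → ι (ι j) ≡ j
  ι-involutive j = begin
    ι (ι j)                    ≡⟨ coset-⁻¹ (repQ j ⁻¹) ⟨
    coset ((repQ j ⁻¹) ⁻¹)     ≡⟨ cong coset (⁻¹-involutive (repQ j)) ⟩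
    coset (repQ j)             ≡⟨ coset-repQ j ⟩
    j                          ∎
    where open ≡-Reasoning

  -- An ι-orbit {j, ι j} on R/K is named by its smaller element, its leader.
  Leader : Fin q → Set
  Leader j = j Fin.≤ ι j

  Leader? : ∀ j → Dec (Leader j)
  Leader? j = j ≤? ι j

  leader : Fin q → Fin q
  leader j with Leader? j
  ... | yes _ = j
  ... | no  _ = ι j

  leader-Leader : ∀ j → Leader (leader j)
  leader-Leader j with Leader? j
  ... | yes j≤ιj = j≤ιj
  ... | no  j≰ιj = subst (ι j Fin.≤_) (sym (ι-involutive j)) (<⇒≤ (≰⇒> j≰ιj))

  leader-fixes : ∀ {j} → Leader j → leader j ≡ j
  leader-fixes {j} j≤ιj with Leader? j
  ... | yes _    = refl
  ... | no  j≰ιj = contradiction j≤ιj j≰ιj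

  leader-ι : ∀ j → leader (ι j) ≡ leader j
  leader-ι j with Leader? (ι j) | Leader? j
  ... | yes ιj≤ιιj | yes j≤ιj = Finₚ.≤-antisym (subst (ι j Fin.≤_) (ι-involutive j) ιj≤ιιj) j≤ιj
  ... | yes _      | no  _    = refl
  ... | no  _      | yes _    = ι-involutive j
  ... | no  ιj≰ιιj | no  j≰ιj = contradiction (subst (ι j Fin.≤_) (sym (ι-involutive j)) (<⇒≤ (≰⇒> j≰ιj))) ιj≰ιιj

  orbitOf : Fin n → Fin q
  orbitOf x = leader (coset x)

  orbitOf-⁻¹ : ∀ x → orbitOf (x ⁻¹) ≡ orbitOf x
  orbitOf-⁻¹ x = trans (cong leader (coset-⁻¹ x)) (leader-ι (coset x))

  orbitOf-cong : ∀ {x y} → x ~ y → orbitOf x ≡ orbitOf y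
  orbitOf-cong x~y = cong leader (coset-cong x~y)

  c′ : ℕ
  c′ = (q + i) / 2

  c′≤#leaders : c′ ≤ count Leader?
  c′≤#leaders = begin
    (q + i) / 2                            ≤⟨ /-monoˡ-≤ 2 (+-monoʳ-≤ q i≤#fixed) ⟩
    (q + count (λ j → ι j ≟ j)) / 2        ≡⟨ count-≤σ≡half ι ι-involutive ⟨
    count Leader?                          ∎
    where
    open ≤-Reasoning
    repI = proj₁ I[R/K]
    coset-repI-injective : ∀ {k l} → coset (repI k) ≡ coset (repI l) → k ≡ l
    coset-repI-injective {k} {l} e = proj₁ (proj₂ (proj₂ I[R/K])) k l
      (~-trans (~-repQ-coset (repI k)) (subst (λ t → repQ t ~ repI l) (sym e) (~-sym (~-repQ-coset (repI l)))))
    coset-repI-fixed : ∀ k → ι (coset (repI k)) ≡ coset (repI k)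
    coset-repI-fixed k = trans (sym (coset-⁻¹ (repI k))) (coset-cong (~-selfInverse (proj₁ (proj₂ I[R/K]) k)))
    i≤#fixed : i ≤ count (λ j → ι j ≟ j)
    i≤#fixed = injection⇒≤count (λ j → ι j ≟ j) (coset ∘ repI) coset-repI-injective coset-repI-fixed

  slot : Fin c′ → Fin q
  slot k = enumerate Leader? (inject≤ k c′≤#leaders)

  slot-injective : ∀ {k l} → slot k ≡ slot l → k ≡ l
  slot-injective e = inject≤-injective c′≤#leaders c′≤#leaders _ _ (enumerate-injective Leader? e)

  slot-Leader : ∀ k → Leader (slot k)
  slot-Leader k = enumerate-sound Leader? (inject≤ k c′≤#leaders)

  marked? : ∀ (b : Fin c′ → Bool) j → Dec (∃ λ k → slot k ≡ j × T (b k))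
  marked? b j = any? λ k → (slot k ≟ j) ×-dec T? (b k)

  marked : (Fin c′ → Bool) → Fin q → Bool
  marked b j = does (marked? b j)

  marked-slot : ∀ b k → marked b (slot k) ≡ b k
  marked-slot b k = ≡-from-T (b k)
    (λ T-bk → dec-true (marked? b (slot k)) (k , refl , T-bk))
    (λ ¬T-bk → dec-false (marked? b (slot k)) λ (l , slot-l≡slot-k , T-bl) →
      ¬T-bk (subst (T ∘ b) (slot-injective slot-l≡slot-k) T-bl))

  twist : (Fin c′ → Bool) → Fin n → Bool
  twist b x = marked b (orbitOf x) ∧ inPair x (repQ (orbitOf x))

  twisted : Subset n → (Fin c′ → Bool) → Fin n → Bool
  twisted S b x = lookup S x xor twist b x

  twist-⁻¹ : ∀ b x → twist b (x ⁻¹) ≡ twist b x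
  twist-⁻¹ b x = begin
    marked b (orbitOf (x ⁻¹)) ∧ inPair (x ⁻¹) (repQ (orbitOf (x ⁻¹)))  ≡⟨ cong (λ o → marked b o ∧ inPair (x ⁻¹) (repQ o)) (orbitOf-⁻¹ x) ⟩
    marked b (orbitOf x) ∧ inPair (x ⁻¹) (repQ (orbitOf x))          ≡⟨ cong (marked b (orbitOf x) ∧_) (inPair-⁻¹ x (repQ (orbitOf x))) ⟩
    marked b (orbitOf x) ∧ inPair x (repQ (orbitOf x))               ∎
    where open ≡-Reasoning

  twisted-⁻¹ : ∀ {S} → InverseClosed S → ∀ b x → twisted S b (x ⁻¹) ≡ twisted S b x
  twisted-⁻¹ closed b x = cong₂ _xor_ (member-⁻¹ closed x) (twist-⁻¹ b x)

  member≡twisted-xor-twist : ∀ S b x → lookup S x ≡ twisted S b x xor twist b x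
  member≡twisted-xor-twist S b x = sym (begin
    (lookup S x xor twist b x) xor twist b x   ≡⟨ xor-assoc (lookup S x) _ _ ⟩
    lookup S x xor (twist b x xor twist b x)   ≡⟨ cong (lookup S x xor_) (xor-same (twist b x)) ⟩
    lookup S x xor false                       ≡⟨ xor-identityʳ (lookup S x) ⟩
    lookup S x                                 ∎)
    where open ≡-Reasoning

  twist-on-leader-coset : ∀ b {j y} → Leader j → repQ j ~ y → twist b y ≡ marked b j ∧ inPair y (repQ j)
  twist-on-leader-coset b {j} {y} lj rⱼ~y = cong (λ o → marked b o ∧ inPair y (repQ o)) orbitOf-y≡j
    where
    orbitOf-y≡j : orbitOf y ≡ j
    orbitOf-y≡j = trans (sym (orbitOf-cong rⱼ~y)) (trans (cong leader (coset-repQ j)) (leader-fixes lj))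

  PairLeader? : ∀ x → Dec (x Fin.≤ x ⁻¹)
  PairLeader? x = x ≤? x ⁻¹

  d : ℕ
  d = count PairLeader?

  pairCode : Subset n → (Fin c′ → Bool) → Fin d → Bool
  pairCode S b = twisted S b ∘ enumerate PairLeader?

  orbitCode : (Fin c′ → Bool) → Fin κ → Bool
  orbitCode b = marked b ∘ orbitOf ∘ proj₁ orbits

  encode : Subset n → (Fin c′ → Bool) → Fin (d + κ) → Bool
  encode S b = pairCode S b ++ orbitCode b

  toggled-between : ∀ {Sₐ Sᵦ bₐ bᵦ j} → Leader j → marked bₐ j ≡ true → marked bᵦ j ≡ false →
    (∀ y → twisted Sₐ bₐ y ≡ twisted Sᵦ bᵦ y) →
    ∀ y → repQ j ~ y → lookup Sₐ y ≡ lookup Sᵦ y xor inPair y (repQ j)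
  toggled-between {Sₐ} {Sᵦ} {bₐ} {bᵦ} {j} lj marked-a marked-b agree y rⱼ~y = begin
    lookup Sₐ y                         ≡⟨ member≡twisted-xor-twist Sₐ bₐ y ⟩
    twisted Sₐ bₐ y xor twist bₐ y      ≡⟨ cong₂ _xor_ (agree y) (trans (twist-on-leader-coset bₐ lj rⱼ~y) (cong (_∧ p) marked-a)) ⟩
    twisted Sᵦ bᵦ y xor p               ≡⟨ cong (λ t → (lookup Sᵦ y xor t) xor p) (trans (twist-on-leader-coset bᵦ lj rⱼ~y) (cong (_∧ p) marked-b)) ⟩
    (lookup Sᵦ y xor false) xor p       ≡⟨ cong (_xor p) (xor-identityʳ (lookup Sᵦ y)) ⟩
    lookup Sᵦ y xor p                   ∎
    where
    open ≡-Reasoning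
    p = inPair y (repQ j)

  module _ {S₁ S₂ : Subset n} (S₁∈ℒ : Inℒ S₁) (S₂∈ℒ : Inℒ S₂) {b₁ b₂ : Fin c′ → Bool}
           (same-code : ∀ w → encode S₁ b₁ w ≡ encode S₂ b₂ w) where

    twisted-agree-on-pair-leaders : ∀ {x} → x Fin.≤ x ⁻¹ → twisted S₁ b₁ x ≡ twisted S₂ b₂ x
    twisted-agree-on-pair-leaders x≤x⁻¹ =
      subst (λ y → twisted S₁ b₁ y ≡ twisted S₂ b₂ y) (proj₂ found) (pairCodes-agree (proj₁ found))
      where
      found = enumerate-surjective PairLeader? x≤x⁻¹
      pairCodes-agree : ∀ k → pairCode S₁ b₁ k ≡ pairCode S₂ b₂ k
      pairCodes-agree k = begin
        pairCode S₁ b₁ k          ≡⟨ lookup-++ˡ (pairCode S₁ b₁) (orbitCode b₁) k ⟨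
        encode S₁ b₁ (k ↑ˡ κ)     ≡⟨ same-code (k ↑ˡ κ) ⟩
        encode S₂ b₂ (k ↑ˡ κ)     ≡⟨ lookup-++ˡ (pairCode S₂ b₂) (orbitCode b₂) k ⟩
        pairCode S₂ b₂ k          ∎
        where open ≡-Reasoning

    twisted-agree : ∀ x → twisted S₁ b₁ x ≡ twisted S₂ b₂ x
    twisted-agree x = [ twisted-agree-on-pair-leaders , via-inverse ]′ (Finₚ.≤-total x (x ⁻¹))
      where
      open ≡-Reasoning
      via-inverse : x ⁻¹ Fin.≤ x → twisted S₁ b₁ x ≡ twisted S₂ b₂ x
      via-inverse x⁻¹≤x = begin
        twisted S₁ b₁ x          ≡⟨ twisted-⁻¹ (proj₁ S₁∈ℒ) b₁ x ⟨
        twisted S₁ b₁ (x ⁻¹)     ≡⟨ twisted-agree-on-pair-leaders (subst (x ⁻¹ Fin.≤_) (sym (⁻¹-involutive x)) x⁻¹≤x) ⟩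
        twisted S₂ b₂ (x ⁻¹)     ≡⟨ twisted-⁻¹ (proj₁ S₂∈ℒ) b₂ x ⟩
        twisted S₂ b₂ x          ∎

    marked-agree-on-orbit-representatives : ∀ o → marked b₁ (orbitOf (proj₁ orbits o)) ≡ marked b₂ (orbitOf (proj₁ orbits o))
    marked-agree-on-orbit-representatives o = begin
      orbitCode b₁ o           ≡⟨ lookup-++ʳ (pairCode S₁ b₁) (orbitCode b₁) o ⟨
      encode S₁ b₁ (d ↑ʳ o)    ≡⟨ same-code (d ↑ʳ o) ⟩
      encode S₂ b₂ (d ↑ʳ o)    ≡⟨ lookup-++ʳ (pairCode S₂ b₂) (orbitCode b₂) o ⟩
      orbitCode b₂ o           ∎
      where open ≡-Reasoning

    member-agree : ∀ {y} → twist b₁ y ≡ twist b₂ y → lookup S₁ y ≡ lookup S₂ y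
    member-agree {y} twists-agree = begin
      lookup S₁ y                        ≡⟨ member≡twisted-xor-twist S₁ b₁ y ⟩
      twisted S₁ b₁ y xor twist b₁ y     ≡⟨ cong₂ _xor_ (twisted-agree y) twists-agree ⟩
      twisted S₂ b₂ y xor twist b₂ y     ≡⟨ member≡twisted-xor-twist S₂ b₂ y ⟨
      lookup S₂ y                        ∎
      where open ≡-Reasoning

    cosetMeet-agree-on-representatives : ∀ j → cosetMeet S₁ (repQ j) ≡ cosetMeet S₂ (repQ j)
    cosetMeet-agree-on-representatives j = begin
      cosetMeet S₁ x    ≡⟨ cosetMeet-orbit S₁∈ℒ x∼r ⟩
      cosetMeet S₁ r    ≡⟨ cosetMeet-agree (λ y r~y → member-agree (twist-agree r~y)) ⟩
      cosetMeet S₂ r    ≡⟨ cosetMeet-orbit S₂∈ℒ x∼r ⟨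
      cosetMeet S₂ x    ∎
      where
      open ≡-Reasoning
      x = repQ j
      o = proj₁ (proj₂ (proj₂ (proj₂ orbits)) x tt)
      x∼r = proj₂ (proj₂ (proj₂ (proj₂ orbits)) x tt)
      r = proj₁ orbits o
      twist-agree : ∀ {y} → r ~ y → twist b₁ y ≡ twist b₂ y
      twist-agree {y} r~y = cong (_∧ inPair y (repQ (orbitOf y)))
        (subst (λ t → marked b₁ t ≡ marked b₂ t) (orbitOf-cong r~y) (marked-agree-on-orbit-representatives o))

    marked-agree : ∀ j → Leader j → marked b₁ j ≡ marked b₂ j
    marked-agree j lj = ≡-unless-opposite
      (λ m₁ m₂ → cosetMeet-toggle (proj₁ S₂∈ℒ) (toggled-between {S₁} {S₂} lj m₁ m₂ twisted-agree) (cosetMeet-agree-on-representatives j))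
      (λ m₁ m₂ → cosetMeet-toggle (proj₁ S₁∈ℒ) (toggled-between {S₂} {S₁} lj m₂ m₁ (sym ∘ twisted-agree)) (sym (cosetMeet-agree-on-representatives j)))

    encode-injective : S₁ ≡ S₂ × (∀ k → b₁ k ≡ b₂ k)
    encode-injective = S₁≡S₂ , b₁≗b₂
      where
      b₁≗b₂ : ∀ k → b₁ k ≡ b₂ k
      b₁≗b₂ k = trans (sym (marked-slot b₁ k)) (trans (marked-agree (slot k) (slot-Leader k)) (marked-slot b₂ k))
      S₁≡S₂ : S₁ ≡ S₂
      S₁≡S₂ = begin
        S₁                    ≡⟨ tabulate∘lookup S₁ ⟨
        tabulate (lookup S₁)  ≡⟨ tabulate-cong (λ y → member-agree (cong (_∧ inPair y (repQ (orbitOf y))) (marked-agree (orbitOf y) (leader-Leader (coset y))))) ⟩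
        tabulate (lookup S₂)  ≡⟨ tabulate∘lookup S₂ ⟩
        S₂                    ∎
        where open ≡-Reasoning

lemma3p10 : ∀ {n} (𝑅 : FinGroup n) (Gs : List (Fin n → Fin n)) →
    let open Setting 𝑅 Gs in
    IsPermGroup → IsTransitive → ContainsR → ProperOverR →
    -- q = |R/K|, i = |I(R/K)|, κ = number of ⟨H,ι⟩-orbits on R/K
    (q i κ : ℕ) →
    NumClassesOn (λ _ → ⊤) SameCoset q →
    NumClassesOn (λ x → InK (x ∙ x)) SameCoset i →
    NumClassesOn (λ _ → ⊤) HιOrb κ →
    -- any list of distinct members of 𝓛 has length ≤ 2^(𝐜(R) − 𝐜(R/K) + κ)
    (Ls : List (Subset n)) → Unique Ls → All Inℒ Ls →
    length Ls * 2 ^ ((q + i) / 2) ≤ 2 ^ (cR + κ)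
lemma3p10 𝑅 Gs G _ R≤G _ q i κ R/K I[R/K] orbits Ls unique all∈ℒ = begin
  length Ls * 2 ^ c′  ≤⟨ injective-encoding⇒≤ (encode ∘ List.lookup Ls) encode∘lookup-injective ⟩
  2 ^ (d + κ)         ≤⟨ ^-monoʳ-≤ 2 (+-monoˡ-≤ κ count-≤⁻¹≤cR) ⟩
  2 ^ (cR + κ)        ∎
  where
  open Setting 𝑅 Gs using (cR)
  open Cosets 𝑅 Gs using (count-≤⁻¹≤cR)
  open Encoding 𝑅 Gs G R≤G q i κ R/K I[R/K] orbits
  open ≤-Reasoning
  encode∘lookup-injective : ∀ {l l′ u u′} → encode (List.lookup Ls l) u ≗ encode (List.lookup Ls l′) u′ → l ≡ l′ × u ≗ u′
  encode∘lookup-injective {l} {l′} same =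
    let Sₗ≡Sₗ′ , u≗u′ = encode-injective (All.lookup all∈ℒ (∈-lookup l)) (All.lookup all∈ℒ (∈-lookup l′)) same
    in Unique⇒lookup-injective unique Sₗ≡Sₗ′ , u≗u′
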